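{- For each integer $n\ge 3$ and each $\mathscr{X}\in\{\mathscr{M}^{KI},\mathscr{M}^{KK},\mathscr{A}^{KK},\mathscr{H}^{KK}\}$, we have $\alpha\text{ - }\mathrm{tw}(Q_n(\mathscr{X}_n))\le 2$ and $\alpha^{\mathrm{loc}}(Q_n(\mathscr{X}_n))\le 3$.
   Context: All graphs finite and simple. For positive integers $k,n$, let $X^i=\{x^i_1,\dots,x^i_n\}$ ($i\in[k]$) be pairwise disjoint sets, and $y^1,\dots,y^k$, $z^1,\dots,z^{k-1}$ further distinct vertices. Define: $Q_k(\mathscr{M}^{KK}_n)$: vertex set $\bigcup_i X^i\cup\{y^1,\dots,y^k\}$, edges $x^i_jx^{i+1}_j$ for $i\in[k-1]$, $j\in[n]$, and each $X^i\cup\{y^i\}$ is a clique. $Q_k(\mathscr{M}^{KI}_n)$: vertex set $\bigcup_i X^i\cup\{y^i: i\le k \text{ odd}\}$, edges $x^i_jx^{i+1}_j$ for $i\in[k-1]$, $j\in[n]$, and $X^i\cup\{y^i\}$ is a clique for each odd $i\le k$ (no other edges). $Q_k(\mathscr{H}^{KK}_n)$: vertex set $\bigcup_i X^i\cup\{y^1,\dots,y^k\}$, edges $x^i_jx^{i+1}_l$ for $i\in[k-1]$ and $j\le l$, and each $X^i\cup\{y^i\}$ a clique. $Q_k(\mathscr{A}^{KK}_n)$: vertex set $\bigcup_i X^i\cup\{y^1,\dots,y^k\}\cup\{z^1,\dots,z^{k-1}\}$, edges $x^i_jx^{i+1}_l$ for $i\in[k-1]$ and $j\neq l$, each $X^i\cup\{y^i\}$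 a clique, and $z^i$ adjacent to every vertex of $X^i\cup X^{i+1}$. $\alpha\text{ - }\mathrm{tw}(G)$ is the minimum over tree-decompositions $(T,\beta)$ of $G$ of $\max_t\alpha(G[\beta(t)])$; $\alpha^{\mathrm{loc}}(G)=\max_v\alpha(G[N[v]])$, $\alpha$ the independence number. -}

module Defs where

open import Data.Nat using (ℕ; zero; suc; _≤_; _<_; _%_)
open import Data.Fin using (Fin; toℕ)
open import Data.List using (List; []; _∷_; length; _∷ʳ_)
open import Data.List.Relation.Unary.All using (All)
open import Data.List.Relation.Unary.Linked using (Linked)
open import Data.List.Relation.Unary.Unique.Propositional using (Unique)
open import Data.List.Membership.Propositional using (_∈_)
open import Data.Product using (Σ; ∃; _×_; _,_)
open import Data.Sum using (_⊎_)
open import Data.Unit using (⊤)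
open import Data.Empty using (⊥)
open import Relation.Nullary using (¬_)
open import Relation.Binary.PropositionalEquality using (_≡_; _≢_)

record Graph : Set₁ where
  field
    V   : Set
    _~_ : V → V → Set
open Graph public

data Reach {A : Set} (R : A → A → Set) : A → A → Set where
  here : ∀ {a} → Reach R a a
  step : ∀ {a b c} → R a b → Reach R b c → Reach R a c

IndepIn : (G : Graph) → (V G → Set) → List (V G) → Set
IndepIn G S I =
  All S I × Unique I × (∀ {u v} → u ∈ I → v ∈ I → ¬ (_~_ G u v))

αInduced≤ : (G : Graph) → (V G → Set) → ℕ → Set
αInduced≤ G S c = ∀ (I : List (V G)) → IndepIn G S I → length I ≤ c

N[_] : {G : Graph} → V G → V G → Set
N[_] {G} v u = (u ≡ v) ⊎ _~_ G v u

αloc≤ : Graph → ℕ → Set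
αloc≤ G c = ∀ (v : V G) → αInduced≤ G (N[_] {G} v) c

record Tree : Set₁ where
  field
    m       : ℕ
    _—_     : Fin m → Fin m → Set
    —-sym   : ∀ {s t} → s — t → t — s
    —-irr   : ∀ {s} → ¬ (s — s)
    connected : ∀ (s t : Fin m) → Reach _—_ s t
    acyclic : ¬ (Σ (Fin m) λ a → Σ (List (Fin m)) λ rest →
                   (2 ≤ length rest) × Unique (a ∷ rest) × Linked _—_ ((a ∷ rest) ∷ʳ a))
open Tree public

ConnectedIn : (T : Tree) → (Fin (m T) → Set) → Set
ConnectedIn T S = ∀ s t → S s → S t →
  Reach (λ a b → S a × S b × _—_ T a b) s t

record TreeDecomposition (G : Graph) (T : Tree) : Set₁ where
  field
    β      : Fin (m T) → V G → Set
    cover  : ∀ (v : V G) → ∃ λ t → β t v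
    edges  : ∀ (u v : V G) → _~_ G u v → ∃ λ t → β t u × β t v
    interp : ∀ (v : V G) → ConnectedIn T (λ t → β t v)
open TreeDecomposition public

αtw≤ : Graph → ℕ → Set₁
αtw≤ G c = Σ Tree λ T → Σ (TreeDecomposition G T) λ D →
  ∀ (t : Fin (m T)) → αInduced≤ G (β D t) c

-- The graphs Q_k(𝒳_n).  Indices are 0-based: Fin k index i stands for
-- layer i+1, Fin n index j stands for j+1.

data Family : Set where
  MKI MKK AKK HKK : Family

-- y^i exists (and X^i ∪ {y^i} is a clique); for MKI only for odd i (1-based),
-- i.e. even 0-based index
HasY : Family → {k : ℕ} → Fin k → Set
HasY MKI i = toℕ i % 2 ≡ 0
HasY MKK i = ⊤
HasY AKK i = ⊤
HasY HKK i = ⊤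

HasZ : Family → (k : ℕ) → Fin k → Set
HasZ AKK k i = suc (toℕ i) < k
HasZ MKI k i = ⊥
HasZ MKK k i = ⊥
HasZ HKK k i = ⊥

LayerOK : Family → {n : ℕ} → Fin n → Fin n → Set
LayerOK MKI j l = j ≡ l
LayerOK MKK j l = j ≡ l
LayerOK HKK j l = toℕ j ≤ toℕ l
LayerOK AKK j l = j ≢ l

data QV (F : Family) (k n : ℕ) : Set where
  x : Fin k → Fin n → QV F k n
  y : (i : Fin k) → HasY F i → QV F k n
  z : (i : Fin k) → HasZ F k i → QV F k n

-- generating (directed, possibly reflexive) edge relation
data Base (F : Family) (k n : ℕ) : QV F k n → QV F k n → Set where
  layer : ∀ {i i' : Fin k} {j l : Fin n} →
          suc (toℕ i) ≡ toℕ i' → LayerOK F j l → Base F k n (x i j) (x i' l)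
  cliqueXX : ∀ {i : Fin k} {j l : Fin n} → HasY F i → Base F k n (x i j) (x i l)
  cliqueXY : ∀ {i : Fin k} {j : Fin n} (p : HasY F i) → Base F k n (x i j) (y i p)
  zLow  : ∀ {i : Fin k} {j : Fin n} (p : HasZ F k i) → Base F k n (z i p) (x i j)
  zHigh : ∀ {i i' : Fin k} {j : Fin n} (p : HasZ F k i) →
          suc (toℕ i) ≡ toℕ i' → Base F k n (z i p) (x i' j)

QAdj : (F : Family) (k n : ℕ) → QV F k n → QV F k n → Set
QAdj F k n u v = (Base F k n u v ⊎ Base F k n v u) × (u ≢ v)

Q : Family → ℕ → ℕ → Graph
Q F k n = record { V = QV F k n ; _~_ = QAdj F k n }

-- An independence bound α(G[S]) ≤ c follows, by pigeonhole, from a cover of S by c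
-- cliques. Trees are presented by a parent map that decreases a height; a family of
-- bags is then a tree-decomposition as soon as, for every vertex v, the nodes whose bag
-- contains v are closed under passing to the parent, up to a topmost such node.
-- When every layer X^i carries its apex y^i (𝓜^KK, 𝓐^KK, 𝓗^KK), the bags
-- X^i ∪ X^{i+1} ∪ {y^i, z^i} strung along a path form a tree-decomposition, each bag
-- being covered by the cliques X^i ∪ {y^i} and X^{i+1} ∪ {z^i}. In 𝓜^KI every other
-- layer is an independent set, so no bag may contain such a layer: a spine bag for
-- layer s holds the clique layers at distance at most one from s (at most two of
-- them, by parity), and below it hangs, for every column j of an apex-free layer s,
-- the leaf bag {x^{s-1}_j, x^s_j, x^{s+1}_j}, which is covered by the edge
-- x^{s-1}_j x^s_j and the vertex x^{s+1}_j. A closed neighbourhood N[v] is covered by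
-- three cliques: the clique of v's own layer and one clique reaching into each of
-- the two adjacent layers.
module Submission where

open import Defs
open import Data.Empty using (⊥; ⊥-elim)
open import Data.Fin using (Fin; zero; suc; toℕ; pred; inject₁) renaming (_<_ to _<ᶠ_)
open import Data.Fin.Properties using (toℕ-injective; toℕ-inject₁; pred<; pigeonhole; +↔⊎; *↔×)
  renaming (_≟_ to _≟ᶠ_)
open import Data.List using (List; []; _∷_; length; _∷ʳ_; map; lookup; [_])
open import Data.List.Properties using (length-map; map-++)
open import Data.List.Membership.Propositional using (_∈_)
open import Data.List.Membership.Propositional.Properties using (∈-lookup)
open import Data.List.Relation.Unary.All as All using (All; _∷_)
open import Data.List.Relation.Unary.Any as Any using (Any; here; there)
open import Data.List.Relation.Unary.AllPairs using (_∷_)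
open import Data.List.Relation.Unary.Any.Properties using (lookup-index)
open import Data.List.Relation.Unary.Linked using (Linked; [-]; _∷_)
import Data.List.Relation.Unary.Linked.Properties as Linked
open import Data.List.Relation.Unary.Unique.Propositional using (Unique)
import Data.List.Relation.Unary.Unique.Propositional.Properties as Unique
open import Data.Nat as ℕ using (ℕ; zero; suc; _≤_; _<_; _%_; z≤n; s≤s)
open import Data.Nat.Properties
  using (≤-refl; ≤-trans; <-trans; <-irrefl; ≤-antisym; n≤1+n; m≤n⇒m≤1+n; m≤n⇒m<n∨m≡n;
         ≮⇒≥; ≤-irrelevant; ≡-irrelevant; <-cmp)
open import Data.Product using (Σ; _×_; _,_; proj₁; proj₂)
open import Data.Sum using (_⊎_; inj₁; inj₂)
open import Data.Sum.Function.Propositional using (_⊎-↔_)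
open import Data.Sum.Properties using (inj₁-injective)
open import Data.Unit using (⊤; tt)
open import Function using (_∘_; _on_; id)
open import Function.Bundles using (Inverse; Injection; _↔_)
open import Function.Properties.Inverse using (↔-refl; ↔-trans; ↔-sym; ↔⇒↣)
open import Relation.Binary.Definitions using (tri<; tri≈; tri>)
open import Relation.Binary.PropositionalEquality
  using (_≡_; _≢_; refl; sym; trans; cong; subst; subst₂; module ≡-Reasoning)
open import Relation.Nullary using (¬_; Dec; yes; no)
open import Relation.Nullary.Decidable using (via-injection)

Reach-trans : ∀ {A : Set} {R : A → A → Set} {a b c} → Reach R a b → Reach R b c → Reach R a c
Reach-trans here q = q
Reach-trans (step r p) q = step r (Reach-trans p q)

Reach-map : ∀ {A B : Set} {R : A → A → Set} {S : B → B → Set} (f : A → B) →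
            (∀ {a b} → R a b → S (f a) (f b)) → ∀ {a b} → Reach R a b → Reach S (f a) (f b)
Reach-map f g here = here
Reach-map f g (step r p) = step (g r) (Reach-map f g p)

Reach-reverse : ∀ {A : Set} {R : A → A → Set} → (∀ {a b} → R a b → R b a) →
                ∀ {a b} → Reach R a b → Reach R b a
Reach-reverse sym-R here = here
Reach-reverse sym-R (step r p) = Reach-trans (Reach-reverse sym-R p) (step (sym-R r) here)

Cycle : {A : Set} → (A → A → Set) → Set
Cycle {A} R = Σ A λ a → Σ (List A) λ rest →
  (2 ≤ length rest) × Unique (a ∷ rest) × Linked R ((a ∷ rest) ∷ʳ a)

Cycle-map : ∀ {A B : Set} {R : B → B → Set} (f : A → B) →
            (∀ {a b} → f a ≡ f b → a ≡ b) → Cycle (R on f) → Cycle R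
Cycle-map {R = R} f f-injective (a , rest , long , unique , linked) =
  f a , map f rest , subst (2 ≤_) (sym (length-map f rest)) long ,
  Unique.map⁺ f-injective unique ,
  subst (Linked R) (map-++ f (a ∷ rest) [ a ]) (Linked.map⁺ linked)

-- Independence numbers and clique covers

Clique : (G : Graph) → (V G → Set) → Set
Clique G C = ∀ {u w} → C u → C w → u ≢ w → _~_ G u w

αInduced≤-mono : ∀ {G S c d} → c ≤ d → αInduced≤ G S c → αInduced≤ G S d
αInduced≤-mono c≤d α≤c I indep = ≤-trans (α≤c I indep) c≤d

Unique-lookup-≢ : ∀ {A : Set} {xs : List A} → Unique xs →
                  ∀ {i j} → i <ᶠ j → lookup xs i ≢ lookup xs j
Unique-lookup-≢ {xs = _ ∷ _} (x∉ ∷ _) {zero} {suc j} _ = All.lookup x∉ (∈-lookup j)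
Unique-lookup-≢ {xs = _ ∷ _} (_ ∷ unique) {suc i} {suc j} (s≤s i<j) = Unique-lookup-≢ unique i<j

α≤-cliqueCover : (G : Graph) {S : V G → Set} (Cs : List (V G → Set)) → All (Clique G) Cs →
                 (∀ {u} → S u → Any (λ C → C u) Cs) → αInduced≤ G S (length Cs)
α≤-cliqueCover G Cs cliques covering I (I⊆S , unique , independent) = ≮⇒≥ collision
  where
    label : Fin (length I) → Fin (length Cs)
    label k = Any.index (covering (All.lookup I⊆S (∈-lookup k)))

    inLabel : ∀ k → lookup Cs (label k) (lookup I k)
    inLabel k = lookup-index (covering (All.lookup I⊆S (∈-lookup k)))

    collision : ¬ (length Cs < length I)
    collision Cs<I with pigeonhole Cs<I label
    ... | i , j , i<j , same =
      independent (∈-lookup i) (∈-lookup j)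
        (All.lookup cliques (∈-lookup (label j))
          (subst (λ c → lookup Cs c (lookup I i)) same (inLabel i)) (inLabel j)
          (Unique-lookup-≢ unique i<j))

-- Trees given by a parent function

module RootedTree {A : Set} {m : ℕ} (enum : Fin m ↔ A) (parent : A → A) (root : A)
                  (height : A → ℕ) (height-parent : ∀ {a} → a ≢ root → height (parent a) < height a)
  where

  open Inverse enum using (to; from; strictlyInverseˡ; strictlyInverseʳ)

  ParentEdge : A → A → Set
  ParentEdge a b = (parent a ≡ b × a ≢ root) ⊎ (parent b ≡ a × b ≢ root)

  ParentEdge-sym : ∀ {a b} → ParentEdge a b → ParentEdge b a
  ParentEdge-sym (inj₁ e) = inj₂ e
  ParentEdge-sym (inj₂ e) = inj₁ e

  height-up : ∀ {a b} → parent a ≡ b → a ≢ root → height b < height a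
  height-up refl a≢root = height-parent a≢root

  ParentEdge-irrefl : ∀ {a} → ¬ ParentEdge a a
  ParentEdge-irrefl (inj₁ (e , a≢root)) = <-irrefl refl (height-up e a≢root)
  ParentEdge-irrefl (inj₂ (e , a≢root)) = <-irrefl refl (height-up e a≢root)

  NonBacktracking : List A → Set
  NonBacktracking (a ∷ b ∷ c ∷ ws) = a ≢ c × NonBacktracking (b ∷ c ∷ ws)
  NonBacktracking _ = ⊤

  lastOf : A → List A → A
  lastOf a [] = a
  lastOf a (b ∷ ws) = lastOf b ws

  penultimateOf : A → A → List A → A
  penultimateOf a b [] = a
  penultimateOf a b (c ∷ ws) = penultimateOf b c ws

  -- "Up" means towards the root. A walk a b … w' w either ends by stepping down,
  -- starts by stepping up, or does both.
  data Shape (a b : A) (ws : List A) : Set where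
    descends : height a < height (lastOf b ws) → parent (lastOf b ws) ≡ penultimateOf a b ws →
               Shape a b ws
    ascends  : height (lastOf b ws) < height a → parent a ≡ b → Shape a b ws
    peaks    : parent a ≡ b → parent (lastOf b ws) ≡ penultimateOf a b ws → Shape a b ws

  walkShape : ∀ a b ws → Linked ParentEdge (a ∷ b ∷ ws) → NonBacktracking (a ∷ b ∷ ws) →
              Shape a b ws
  walkShape a b [] (inj₁ (e , a≢root) ∷ [-]) _ = ascends (height-up e a≢root) e
  walkShape a b [] (inj₂ (e , b≢root) ∷ [-]) _ = descends (height-up e b≢root) e
  walkShape a b (c ∷ ws) (ab ∷ walk) (a≢c , nonBacktracking)
    with walkShape b c ws walk nonBacktracking | ab
  ... | descends _ down | inj₁ (up , _) = peaks up down
  ... | descends lt down | inj₂ (e , b≢root) = descends (<-trans (height-up e b≢root) lt) down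
  ... | ascends lt _ | inj₁ (up , a≢root) = ascends (<-trans lt (height-up up a≢root)) up
  ... | ascends _ up | inj₂ (e , _) = ⊥-elim (a≢c (trans (sym e) up))
  ... | peaks _ down | inj₁ (up , _) = peaks up down
  ... | peaks up _ | inj₂ (e , _) = ⊥-elim (a≢c (trans (sym e) up))

  snoc-nonBacktracking : ∀ {w e} ys → Unique (w ∷ ys) → All (_≢ e) (w ∷ ys) →
                         NonBacktracking (w ∷ (ys ∷ʳ e))
  snoc-nonBacktracking [] _ _ = tt
  snoc-nonBacktracking (_ ∷ []) _ (w≢e ∷ _) = w≢e , tt
  snoc-nonBacktracking (_ ∷ y₂ ∷ ys) ((_ ∷ w≢y₂ ∷ _) ∷ unique) (_ ∷ ≢e) =
    w≢y₂ , snoc-nonBacktracking (y₂ ∷ ys) unique ≢e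

  lastOf-∷ʳ : ∀ b ws e → lastOf b (ws ∷ʳ e) ≡ e
  lastOf-∷ʳ b [] e = refl
  lastOf-∷ʳ b (c ∷ ws) e = lastOf-∷ʳ c ws e

  penultimateOf-∷ʳ : ∀ a b ws e → penultimateOf a b (ws ∷ʳ e) ≡ lastOf b ws
  penultimateOf-∷ʳ a b [] e = refl
  penultimateOf-∷ʳ a b (c ∷ ws) e = penultimateOf-∷ʳ b c ws e

  lastOf-∈ : ∀ b ws → lastOf b ws ∈ (b ∷ ws)
  lastOf-∈ b [] = here refl
  lastOf-∈ b (c ∷ ws) = there (lastOf-∈ c ws)

  -- In a cycle a r₁ … r_k a, a peak at a would make r₁ and r_k both the parent of a.
  noCycle : ¬ Cycle ParentEdge
  noCycle (_ , _ ∷ [] , s≤s () , _)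
  noCycle (a , r₁ ∷ r₂ ∷ rs , _ , (a∉@(_ ∷ a≢r₂ ∷ _) ∷ unique@(r₁∉ ∷ _)) , cycle)
    with walkShape a r₁ ((r₂ ∷ rs) ∷ʳ a) cycle
           (a≢r₂ , snoc-nonBacktracking (r₂ ∷ rs) unique (All.map (λ ne → ne ∘ sym) a∉))
  ... | descends lt _ = <-irrefl (cong height (sym (lastOf-∷ʳ r₁ (r₂ ∷ rs) a))) lt
  ... | ascends lt _ = <-irrefl (cong height (lastOf-∷ʳ r₁ (r₂ ∷ rs) a)) lt
  ... | peaks up down = All.lookup r₁∉ (lastOf-∈ r₂ rs) (begin
    r₁                                       ≡⟨ up ⟨
    parent a                                 ≡⟨ cong parent (lastOf-∷ʳ r₁ (r₂ ∷ rs) a) ⟨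
    parent (lastOf r₁ ((r₂ ∷ rs) ∷ʳ a))      ≡⟨ down ⟩
    penultimateOf a r₁ ((r₂ ∷ rs) ∷ʳ a)      ≡⟨ penultimateOf-∷ʳ a r₁ (r₂ ∷ rs) a ⟩
    lastOf r₂ rs                             ∎)
    where open ≡-Reasoning

  ClimbsTo : (A → Set) → A → Set
  ClimbsTo S r = ∀ {a} → S a → a ≡ r ⊎ (a ≢ root × S (parent a))

  InducedEdge : (A → Set) → A → A → Set
  InducedEdge S a b = S a × S b × ParentEdge a b

  climb : ∀ {S r} → ClimbsTo S r → ∀ {a} → S a → Reach (InducedEdge S) a r
  climb {S} {r} climbs = go _ ≤-refl
    where
      go : ∀ fuel {a} → height a < fuel → S a → Reach (InducedEdge S) a r
      go (suc fuel) {a} h<fuel Sa with climbs Sa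
      ... | inj₁ refl = here
      ... | inj₂ (a≢root , Sp) =
        step (Sa , Sp , inj₁ (refl , a≢root))
             (go fuel (≤-trans (height-parent a≢root) (ℕ.s≤s⁻¹ h<fuel)) Sp)

  pullback : ∀ {R : A → A → Set} {a b} → Reach R a b → Reach (R on to) (from a) (from b)
  pullback {R} = Reach-map from λ {a} {b} →
    subst₂ R (sym (strictlyInverseˡ a)) (sym (strictlyInverseˡ b))

  climb-pullback : ∀ {S r} → ClimbsTo S r → ∀ {t} → S (to t) →
                   Reach (InducedEdge S on to) t (from r)
  climb-pullback climbs {t} St =
    subst (λ s → Reach _ s _) (strictlyInverseʳ t) (pullback (climb climbs St))

  climbs⇒connected : ∀ {S r} → ClimbsTo S r → ∀ s t → S (to s) → S (to t) →
                     Reach (InducedEdge S on to) s t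
  climbs⇒connected climbs s t Ss St =
    Reach-trans (climb-pullback climbs Ss)
      (Reach-reverse (λ (Sa , Sb , e) → Sb , Sa , ParentEdge-sym e) (climb-pullback climbs St))

  _≟_ : (a b : A) → Dec (a ≡ b)
  _≟_ = via-injection (↔⇒↣ (↔-sym enum)) _≟ᶠ_

  everything-climbs-to-root : ClimbsTo (λ _ → ⊤) root
  everything-climbs-to-root {a} _ with a ≟ root
  ... | yes a≡root = inj₁ a≡root
  ... | no a≢root = inj₂ (a≢root , tt)

  tree : Tree
  tree = record
    { m = m
    ; _—_ = ParentEdge on to
    ; —-sym = ParentEdge-sym
    ; —-irr = ParentEdge-irrefl
    ; connected = λ s t → Reach-map id (proj₂ ∘ proj₂)
        (climbs⇒connected everything-climbs-to-root s t tt tt)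
    ; acyclic = noCycle ∘ Cycle-map to (Injection.injective (↔⇒↣ enum))
    }

  SubtreeAt : (A → Set) → A → Set
  SubtreeAt S r = S r × ClimbsTo S r

  αtw≤-fromBags : (G : Graph) {c : ℕ} (bag : A → V G → Set) →
                  (∀ v → Σ A (SubtreeAt (λ a → bag a v))) →
                  (∀ {u v} → _~_ G u v → Σ A λ a → bag a u × bag a v) →
                  (∀ a → αInduced≤ G (bag a) c) → αtw≤ G c
  αtw≤-fromBags G bag subtree edge bounded = tree , decomposition , bounded ∘ to
    where
      at : ∀ {P : A → Set} {a} → P a → P (to (from a))
      at {P} {a} = subst P (sym (strictlyInverseˡ a))

      decomposition : TreeDecomposition G tree
      decomposition = record
        { β = bag ∘ to
        ; cover = λ v → let (r , inR , _) = subtree v in from r , at {λ a → bag a v} inR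
        ; edges = λ u v uv → let (a , u∈ , v∈) = edge uv in
                    from a , at {λ a → bag a u} u∈ , at {λ a → bag a v} v∈
        ; interp = λ v → climbs⇒connected (proj₂ (proj₂ (subtree v)))
        }

-- Distance and parity of layer indices

toℕ-pred : ∀ {k} (i : Fin k) → toℕ (pred i) ≡ ℕ.pred (toℕ i)
toℕ-pred zero = refl
toℕ-pred (suc i) = toℕ-inject₁ i

pred-cases : ∀ {k} (t : Fin (suc k)) → pred t ≡ t ⊎ (t ≢ zero × toℕ t ≡ suc (toℕ (pred t)))
pred-cases zero = inj₁ refl
pred-cases (suc t) = inj₂ ((λ ()) , cong suc (sym (toℕ-inject₁ t)))

Close : ℕ → ℕ → Set
Close a b = a ≤ suc b × b ≤ suc a

close-refl : ∀ a → Close a a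
close-refl a = n≤1+n a , n≤1+n a

close-suc : ∀ a → Close a (suc a)
close-suc a = m≤n⇒m≤1+n (n≤1+n a) , ≤-refl

close-sym : ∀ {a b} → Close a b → Close b a
close-sym (a≤ , b≤) = b≤ , a≤

close-cases : ∀ {a b} → Close a b → a ≡ b ⊎ suc a ≡ b ⊎ suc b ≡ a
close-cases {a} {b} (a≤ , b≤) with <-cmp a b
... | tri≈ _ a≡b _ = inj₁ a≡b
... | tri< a<b _ _ = inj₂ (inj₁ (≤-antisym a<b b≤))
... | tri> _ _ b<a = inj₂ (inj₂ (≤-antisym b<a a≤))

Even : ℕ → Set
Even a = a % 2 ≡ 0

even⇒¬even-suc : ∀ a → Even a → ¬ Even (suc a)
even⇒¬even-suc zero _ ()
even⇒¬even-suc (suc zero) ()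
even⇒¬even-suc (suc (suc a)) = even⇒¬even-suc a

¬even⇒even-suc : ∀ a → ¬ Even a → Even (suc a)
¬even⇒even-suc zero odd = ⊥-elim (odd refl)
¬even⇒even-suc (suc zero) _ = refl
¬even⇒even-suc (suc (suc a)) = ¬even⇒even-suc a

¬even⇒suc-pred : ∀ {a} → ¬ Even a → suc (ℕ.pred a) ≡ a
¬even⇒suc-pred {zero} odd = ⊥-elim (odd refl)
¬even⇒suc-pred {suc a} _ = refl

close-even⇒≡ : ∀ {a b} → Close a b → Even a → Even b → a ≡ b
close-even⇒≡ {a} {b} close ea eb with close-cases close
... | inj₁ a≡b = a≡b
... | inj₂ (inj₁ refl) = ⊥-elim (even⇒¬even-suc a ea eb)
... | inj₂ (inj₂ refl) = ⊥-elim (even⇒¬even-suc b eb ea)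

close-odd⇒≡ : ∀ {a b} → Close a b → ¬ Even a → ¬ Even b → a ≡ b
close-odd⇒≡ {a} {b} close oa ob with close-cases close
... | inj₁ a≡b = a≡b
... | inj₂ (inj₁ refl) = ⊥-elim (ob (¬even⇒even-suc a oa))
... | inj₂ (inj₂ refl) = ⊥-elim (oa (¬even⇒even-suc b ob))

close-odd-even : ∀ {a b} → Close a b → ¬ Even a → Even b → b ≡ ℕ.pred a ⊎ b ≡ suc a
close-odd-even close oa eb with close-cases close
... | inj₁ refl = ⊥-elim (oa eb)
... | inj₂ (inj₁ refl) = inj₂ refl
... | inj₂ (inj₂ refl) = inj₁ refl

-- The graphs Q F k n

HasY-irrelevant : ∀ F {k} {i : Fin k} (p q : HasY F i) → p ≡ q
HasY-irrelevant MKI p q = ≡-irrelevant p q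
HasY-irrelevant MKK p q = refl
HasY-irrelevant AKK p q = refl
HasY-irrelevant HKK p q = refl

HasZ-irrelevant : ∀ F k {i : Fin k} (p q : HasZ F k i) → p ≡ q
HasZ-irrelevant AKK k p q = ≤-irrelevant p q
HasZ-irrelevant MKI k () q
HasZ-irrelevant MKK k () q
HasZ-irrelevant HKK k () q

module QGraph (F : Family) (k n : ℕ) where

  Vertex : Set
  Vertex = QV F k n

  Adj : Vertex → Vertex → Set
  Adj = QAdj F k n

  Adj-sym : ∀ {u w} → Adj u w → Adj w u
  Adj-sym (inj₁ b , u≢w) = inj₂ b , u≢w ∘ sym
  Adj-sym (inj₂ b , u≢w) = inj₁ b , u≢w ∘ sym

  coverEdges : ∀ {B : Set} (bag : B → Vertex → Set) →
               (∀ {u v} → Base F k n u v → Σ B λ b → bag b u × bag b v) →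
               ∀ {u v} → Adj u v → Σ B λ b → bag b u × bag b v
  coverEdges bag covered (inj₁ uv , _) = covered uv
  coverEdges bag covered (inj₂ vu , _) = let (b , v∈ , u∈) = covered vu in b , u∈ , v∈

  x-x-adj : ∀ {i i' j l} → toℕ i ≡ toℕ i' → HasY F i → x i j ≢ x i' l → Adj (x i j) (x i' l)
  x-x-adj e h ne with toℕ-injective e
  ... | refl = inj₁ (cliqueXX h) , ne

  x-y-adj : ∀ {i i' j p} → toℕ i ≡ toℕ i' → Adj (x i j) (y i' p)
  x-y-adj e with toℕ-injective e
  ... | refl = inj₁ (cliqueXY _) , λ ()

  z-x-adj : ∀ {i i' j p} → toℕ i ≡ toℕ i' → Adj (z i p) (x i' j)
  z-x-adj e with toℕ-injective e
  ... | refl = inj₁ (zLow _) , λ ()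

  z-x-adj-above : ∀ {i i' j p} → suc (toℕ i) ≡ toℕ i' → Adj (z i p) (x i' j)
  z-x-adj-above e = inj₁ (zHigh _ e) , λ ()

  x-≡ : ∀ {i i' j} → toℕ i ≡ toℕ i' → _≡_ {A = Vertex} (x i j) (x i' j)
  x-≡ e with toℕ-injective e
  ... | refl = refl

  y-≡ : ∀ {i i' p q} → toℕ i ≡ toℕ i' → _≡_ {A = Vertex} (y i p) (y i' q)
  y-≡ e with toℕ-injective e
  ... | refl = cong (y _) (HasY-irrelevant F _ _)

  z-≡ : ∀ {i i' p q} → toℕ i ≡ toℕ i' → _≡_ {A = Vertex} (z i p) (z i' q)
  z-≡ e with toℕ-injective e
  ... | refl = cong (z _) (HasZ-irrelevant F k _ _)

  -- Layers are named by their index in ℕ, so that the neighbouring layers ℕ.pred a and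
  -- suc a need no Fin arithmetic.

  data YClique (a : ℕ) : Vertex → Set where
    x∈ : ∀ {i j} → toℕ i ≡ a → HasY F i → YClique a (x i j)
    y∈ : ∀ {i p} → toℕ i ≡ a → YClique a (y i p)

  data ZLowClique (a : ℕ) : Vertex → Set where
    x∈ : ∀ {i j} → toℕ i ≡ a → HasY F i → ZLowClique a (x i j)
    z∈ : ∀ {i p} → toℕ i ≡ a → ZLowClique a (z i p)

  data ZHighClique (a : ℕ) : Vertex → Set where
    x∈ : ∀ {i j} → toℕ i ≡ suc a → HasY F i → ZHighClique a (x i j)
    z∈ : ∀ {i p} → toℕ i ≡ a → ZHighClique a (z i p)

  YClique-clique : ∀ a → Clique (Q F k n) (YClique a)
  YClique-clique a (x∈ e h) (x∈ e' _) ne = x-x-adj (trans e (sym e')) h ne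
  YClique-clique a (x∈ e _) (y∈ e') _ = x-y-adj (trans e (sym e'))
  YClique-clique a (y∈ e) (x∈ e' _) _ = Adj-sym (x-y-adj (trans e' (sym e)))
  YClique-clique a (y∈ e) (y∈ e') ne = ⊥-elim (ne (y-≡ (trans e (sym e'))))

  ZLowClique-clique : ∀ a → Clique (Q F k n) (ZLowClique a)
  ZLowClique-clique a (x∈ e h) (x∈ e' _) ne = x-x-adj (trans e (sym e')) h ne
  ZLowClique-clique a (x∈ e _) (z∈ e') _ = Adj-sym (z-x-adj (trans e' (sym e)))
  ZLowClique-clique a (z∈ e) (x∈ e' _) _ = z-x-adj (trans e (sym e'))
  ZLowClique-clique a (z∈ e) (z∈ e') ne = ⊥-elim (ne (z-≡ (trans e (sym e'))))

  ZHighClique-clique : ∀ a → Clique (Q F k n) (ZHighClique a)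
  ZHighClique-clique a (x∈ e h) (x∈ e' _) ne = x-x-adj (trans e (sym e')) h ne
  ZHighClique-clique a (x∈ e _) (z∈ e') _ = Adj-sym (z-x-adj-above (trans (cong suc e') (sym e)))
  ZHighClique-clique a (z∈ e) (x∈ e' _) _ = z-x-adj-above (trans (cong suc e) (sym e'))
  ZHighClique-clique a (z∈ e) (z∈ e') ne = ⊥-elim (ne (z-≡ (trans e (sym e'))))

-- Families in which every layer has its apex y^i: 𝓜^KK, 𝓐^KK, 𝓗^KK

module AllApexes (F : Family) (k₀ n : ℕ) (hasY : ∀ {i : Fin (suc k₀)} → HasY F i) where

  k : ℕ
  k = suc k₀

  open QGraph F k n
  open RootedTree (↔-refl {A = Fin k}) pred zero toℕ (λ {a} → pred< a)

  αloc≤3 : αloc≤ (Q F k n) 3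
  αloc≤3 (x i j) = α≤-cliqueCover (Q F k n) _
    (YClique-clique _ ∷ ZHighClique-clique _ ∷ ZLowClique-clique (ℕ.pred (toℕ i)) ∷ All.[]) covering
    where
      covering : ∀ {u} → N[_] {Q F k n} (x i j) u →
              Any (λ C → C u)
                (YClique (toℕ i) ∷ ZHighClique (toℕ i) ∷ ZLowClique (ℕ.pred (toℕ i)) ∷ [])
      covering (inj₁ refl) = here (x∈ refl hasY)
      covering (inj₂ (inj₁ (layer e _) , _)) = there (here (x∈ (sym e) hasY))
      covering (inj₂ (inj₁ (cliqueXX h) , _)) = here (x∈ refl h)
      covering (inj₂ (inj₁ (cliqueXY _) , _)) = here (y∈ refl)
      covering (inj₂ (inj₂ (layer e _) , _)) = there (there (here (x∈ (cong ℕ.pred e) hasY)))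
      covering (inj₂ (inj₂ (cliqueXX h) , _)) = here (x∈ refl h)
      covering (inj₂ (inj₂ (zLow _) , _)) = there (here (z∈ refl))
      covering (inj₂ (inj₂ (zHigh _ e) , _)) = there (there (here (z∈ (cong ℕ.pred e))))
  αloc≤3 (y i p) = αInduced≤-mono (s≤s z≤n)
    (α≤-cliqueCover (Q F k n) (YClique (toℕ i) ∷ []) (YClique-clique _ ∷ All.[]) covering)
    where
      covering : ∀ {u} → N[_] {Q F k n} (y i p) u → Any (λ C → C u) (YClique (toℕ i) ∷ [])
      covering (inj₁ refl) = here (y∈ refl)
      covering (inj₂ (inj₁ () , _))
      covering (inj₂ (inj₂ (cliqueXY _) , _)) = here (x∈ refl hasY)
  αloc≤3 (z i p) = αInduced≤-mono (s≤s (s≤s z≤n))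
    (α≤-cliqueCover (Q F k n) (ZLowClique (toℕ i) ∷ ZHighClique (toℕ i) ∷ [])
      (ZLowClique-clique _ ∷ ZHighClique-clique _ ∷ All.[]) covering)
    where
      covering : ∀ {u} → N[_] {Q F k n} (z i p) u →
              Any (λ C → C u) (ZLowClique (toℕ i) ∷ ZHighClique (toℕ i) ∷ [])
      covering (inj₁ refl) = here (z∈ refl)
      covering (inj₂ (inj₁ (zLow _) , _)) = here (x∈ refl hasY)
      covering (inj₂ (inj₁ (zHigh _ e) , _)) = there (here (x∈ (sym e) hasY))
      covering (inj₂ (inj₂ () , _))

  bag : Fin k → Vertex → Set
  bag t (x e _) = e ≡ t ⊎ toℕ e ≡ suc (toℕ t)
  bag t (y e _) = e ≡ t
  bag t (z e _) = e ≡ t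

  subtree : ∀ v → Σ (Fin k) (SubtreeAt (λ t → bag t v))
  subtree (x e j) = pred e , top (pred-cases e) , climbs
    where
      top : pred e ≡ e ⊎ (e ≢ zero × toℕ e ≡ suc (toℕ (pred e))) → bag (pred e) (x e j)
      top (inj₁ fixed) = inj₁ (sym fixed)
      top (inj₂ (_ , e≡)) = inj₂ e≡

      climbs : ClimbsTo (λ t → bag t (x e j)) (pred e)
      climbs {t} (inj₂ e≡) =
        inj₁ (sym (toℕ-injective (trans (toℕ-pred e) (cong ℕ.pred e≡))))
      climbs {t} (inj₁ refl) with pred-cases t
      ... | inj₁ fixed = inj₁ (sym fixed)
      ... | inj₂ (t≢zero , t≡) = inj₂ (t≢zero , inj₂ t≡)
  subtree (y e _) = e , refl , λ e≡t → inj₁ (sym e≡t)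
  subtree (z e _) = e , refl , λ e≡t → inj₁ (sym e≡t)

  base-bag : ∀ {u v} → Base F k n u v → Σ (Fin k) λ t → bag t u × bag t v
  base-bag (layer {i} e _) = i , inj₁ refl , inj₂ (sym e)
  base-bag (cliqueXX {i} _) = i , inj₁ refl , inj₁ refl
  base-bag (cliqueXY {i} _) = i , inj₁ refl , refl
  base-bag (zLow {i} _) = i , refl , inj₁ refl
  base-bag (zHigh {i} _ e) = i , refl , inj₂ (sym e)

  bag-α≤2 : ∀ t → αInduced≤ (Q F k n) (bag t) 2
  bag-α≤2 t = α≤-cliqueCover (Q F k n) (YClique (toℕ t) ∷ ZHighClique (toℕ t) ∷ [])
    (YClique-clique _ ∷ ZHighClique-clique _ ∷ All.[]) covering
    where
      covering : ∀ {u} → bag t u → Any (λ C → C u) (YClique (toℕ t) ∷ ZHighClique (toℕ t) ∷ [])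
      covering {x _ _} (inj₁ refl) = here (x∈ refl hasY)
      covering {x _ _} (inj₂ e≡) = there (here (x∈ e≡ hasY))
      covering {y _ _} refl = here (y∈ refl)
      covering {z _ _} refl = there (here (z∈ refl))

  αtw≤2 : αtw≤ (Q F k n) 2
  αtw≤2 = αtw≤-fromBags (Q F k n) bag subtree (coverEdges bag base-bag) bag-α≤2

-- The family 𝓜^KI

module MKI (k₀ n : ℕ) where

  k : ℕ
  k = suc k₀

  open QGraph MKI k n

  data ColumnPair (a : ℕ) (j : Fin n) : Vertex → Set where
    lower : ∀ {i} → toℕ i ≡ a → ColumnPair a j (x i j)
    upper : ∀ {i} → toℕ i ≡ suc a → ColumnPair a j (x i j)

  data Cell (a : ℕ) (j : Fin n) : Vertex → Set where
    x∈ : ∀ {i} → toℕ i ≡ a → Cell a j (x i j)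

  ColumnPair-clique : ∀ a j → Clique (Q MKI k n) (ColumnPair a j)
  ColumnPair-clique a j (lower e) (lower e') ne = ⊥-elim (ne (x-≡ (trans e (sym e'))))
  ColumnPair-clique a j (upper e) (upper e') ne = ⊥-elim (ne (x-≡ (trans e (sym e'))))
  ColumnPair-clique a j (lower e) (upper e') ne =
    inj₁ (layer (trans (cong suc e) (sym e')) refl) , ne
  ColumnPair-clique a j (upper e) (lower e') ne =
    inj₂ (layer (trans (cong suc e') (sym e)) refl) , ne

  Cell-clique : ∀ a j → Clique (Q MKI k n) (Cell a j)
  Cell-clique a j (x∈ e) (x∈ e') ne = ⊥-elim (ne (x-≡ (trans e (sym e'))))

  αloc≤3 : αloc≤ (Q MKI k n) 3
  αloc≤3 (x e j) = α≤-cliqueCover (Q MKI k n) _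
    (YClique-clique _ ∷ ColumnPair-clique _ _ ∷ Cell-clique (ℕ.pred (toℕ e)) _ ∷ All.[]) covering
    where
      covering : ∀ {u} → N[_] {Q MKI k n} (x e j) u →
              Any (λ C → C u)
                (YClique (toℕ e) ∷ ColumnPair (toℕ e) j ∷ Cell (ℕ.pred (toℕ e)) j ∷ [])
      covering (inj₁ refl) = there (here (lower refl))
      covering (inj₂ (inj₁ (layer e≡ refl) , _)) = there (here (upper (sym e≡)))
      covering (inj₂ (inj₁ (cliqueXX h) , _)) = here (x∈ refl h)
      covering (inj₂ (inj₁ (cliqueXY _) , _)) = here (y∈ refl)
      covering (inj₂ (inj₂ (layer e≡ refl) , _)) = there (there (here (x∈ (cong ℕ.pred e≡))))
      covering (inj₂ (inj₂ (cliqueXX h) , _)) = here (x∈ refl h)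
      covering (inj₂ (inj₂ (zLow ()) , _))
      covering (inj₂ (inj₂ (zHigh () _) , _))
  αloc≤3 (y e p) = αInduced≤-mono (s≤s z≤n)
    (α≤-cliqueCover (Q MKI k n) (YClique (toℕ e) ∷ []) (YClique-clique _ ∷ All.[]) covering)
    where
      covering : ∀ {u} → N[_] {Q MKI k n} (y e p) u → Any (λ C → C u) (YClique (toℕ e) ∷ [])
      covering (inj₁ refl) = here (y∈ refl)
      covering (inj₂ (inj₁ () , _))
      covering (inj₂ (inj₂ (cliqueXY _) , _)) = here (x∈ refl p)
  αloc≤3 (z _ ())

  -- inj₁ s is the spine node of layer s, inj₂ (s , j) the leaf of column j at layer s
  Node : Set
  Node = Fin k ⊎ (Fin k × Fin n)

  enum : Fin (k ℕ.+ k ℕ.* n) ↔ Node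
  enum = ↔-trans +↔⊎ (↔-refl ⊎-↔ *↔×)

  parent : Node → Node
  parent (inj₁ s) = inj₁ (pred s)
  parent (inj₂ (s , _)) = inj₁ s

  height : Node → ℕ
  height (inj₁ s) = toℕ s
  height (inj₂ (s , _)) = suc (toℕ s)

  height-parent : ∀ {a} → a ≢ inj₁ zero → height (parent a) < height a
  height-parent {inj₁ s} a≢root = pred< s (a≢root ∘ cong inj₁)
  height-parent {inj₂ _} _ = ≤-refl

  open RootedTree enum parent (inj₁ zero) height height-parent

  Near : Fin k → Fin k → Set
  Near s e = Close (toℕ s) (toℕ e)

  Spine : Fin k → Fin k → Set
  Spine s e = HasY MKI e × Near s e

  -- leaves of layers with an apex stay empty
  bag : Node → Vertex → Set
  bag (inj₁ s) (x e _) = Spine s e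
  bag (inj₁ s) (y e _) = Spine s e
  bag (inj₂ (s , l)) (x e j) = ¬ HasY MKI s × j ≡ l × Near s e
  bag (inj₂ _) (y _ _) = ⊥
  bag _ (z _ ())

  near-pred : ∀ e → Near (pred e) e
  near-pred zero = close-refl 0
  near-pred (suc e) rewrite toℕ-inject₁ e = close-suc (toℕ e)

  near-next : ∀ {i i'} → suc (toℕ i) ≡ toℕ i' → Near i i'
  near-next {i} e = subst (Close (toℕ i)) e (close-suc (toℕ i))

  apex-alternates : ∀ {i i' : Fin k} → suc (toℕ i) ≡ toℕ i' → HasY MKI i → ¬ HasY MKI i'
  apex-alternates {i} e apex = even⇒¬even-suc (toℕ i) apex ∘ subst Even (sym e)

  spine-climbs : ∀ {s e} → Near s e → s ≡ pred e ⊎ (s ≢ zero × Near (pred s) e)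
  spine-climbs {zero} {zero} _ = inj₁ refl
  spine-climbs {zero} {suc zero} _ = inj₁ refl
  spine-climbs {zero} {suc (suc _)} (_ , s≤s ())
  spine-climbs {suc s} {e} (s<e , e≤) with m≤n⇒m<n∨m≡n e≤
  ... | inj₁ (s≤s e≤s) = inj₂ ((λ ()) ,
    subst (λ c → Close c (toℕ e)) (sym (toℕ-inject₁ s)) (m≤n⇒m≤1+n (ℕ.s≤s⁻¹ s<e) , e≤s))
  ... | inj₂ e≡ = inj₁ (toℕ-injective (sym (trans (toℕ-pred e) (cong ℕ.pred e≡))))

  spine-subtree : ∀ {v e} →
                  (∀ {s} → bag (inj₁ s) v → Spine s e) → (∀ {s} → Spine s e → bag (inj₁ s) v) →
                  (∀ {a} → bag (inj₂ a) v → Spine (proj₁ a) e) →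
                  ClimbsTo (λ a → bag a v) (inj₁ (pred e))
  spine-subtree toSpine fromSpine leaf {inj₁ s} s∈ with toSpine s∈
  ... | apex , near with spine-climbs near
  ... | inj₁ s≡ = inj₁ (cong inj₁ s≡)
  ... | inj₂ (s≢zero , near') = inj₂ (s≢zero ∘ inj₁-injective , fromSpine (apex , near'))
  spine-subtree toSpine fromSpine leaf {inj₂ _} l∈ = inj₂ ((λ ()) , fromSpine (leaf l∈))

  subtree : ∀ v → Σ Node (SubtreeAt (λ a → bag a v))
  subtree (x e j) with toℕ e % 2 ℕ.≟ 0
  ... | yes apex = inj₁ (pred e) , (apex , near-pred e) ,
    spine-subtree id id (λ (_ , _ , near) → apex , near)
  ... | no noApex = inj₂ (e , j) , (noApex , refl , close-refl (toℕ e)) , climbs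
    where
      climbs : ClimbsTo (λ a → bag a (x e j)) (inj₂ (e , j))
      climbs {inj₁ _} (apex , _) = ⊥-elim (noApex apex)
      climbs {inj₂ _} (noApex' , refl , near) =
        inj₁ (cong (λ s → inj₂ (s , j)) (toℕ-injective (close-odd⇒≡ near noApex' noApex)))
  subtree (y e p) = inj₁ (pred e) , (p , near-pred e) , spine-subtree id id λ ()
  subtree (z _ ())

  base-bag : ∀ {u v} → Base MKI k n u v → Σ Node λ a → bag a u × bag a v
  base-bag (layer {i} {i'} {j} e refl) with toℕ i % 2 ℕ.≟ 0
  ... | yes apex = inj₂ (i' , j) ,
    (apex-alternates e apex , refl , close-sym (near-next e)) ,
    (apex-alternates e apex , refl , close-refl (toℕ i'))
  ... | no noApex = inj₂ (i , j) ,
    (noApex , refl , close-refl (toℕ i)) ,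
    (noApex , refl , near-next e)
  base-bag (cliqueXX {i} h) = inj₁ i , (h , close-refl (toℕ i)) , (h , close-refl (toℕ i))
  base-bag (cliqueXY {i} p) = inj₁ i , (p , close-refl (toℕ i)) , (p , close-refl (toℕ i))
  base-bag (zLow ())
  base-bag (zHigh () _)

  bag-α≤2 : ∀ a → αInduced≤ (Q MKI k n) (bag a) 2
  bag-α≤2 (inj₁ s) with toℕ s % 2 ℕ.≟ 0
  ... | yes even = αInduced≤-mono (s≤s z≤n)
    (α≤-cliqueCover (Q MKI k n) (YClique (toℕ s) ∷ []) (YClique-clique _ ∷ All.[]) covering)
    where
      covering : ∀ {u} → bag (inj₁ s) u → Any (λ C → C u) (YClique (toℕ s) ∷ [])
      covering {x _ _} (apex , near) = here (x∈ (sym (close-even⇒≡ near even apex)) apex)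
      covering {y _ _} (apex , near) = here (y∈ (sym (close-even⇒≡ near even apex)))
  ... | no odd =
    α≤-cliqueCover (Q MKI k n) _ (YClique-clique _ ∷ YClique-clique _ ∷ All.[]) covering
    where
      Cs = YClique (ℕ.pred (toℕ s)) ∷ YClique (suc (toℕ s)) ∷ []

      covering : ∀ {u} → bag (inj₁ s) u → Any (λ C → C u) Cs
      covering {x _ _} (apex , near) with close-odd-even near odd apex
      ... | inj₁ below = here (x∈ below apex)
      ... | inj₂ above = there (here (x∈ above apex))
      covering {y _ _} (apex , near) with close-odd-even near odd apex
      ... | inj₁ below = here (y∈ below)
      ... | inj₂ above = there (here (y∈ above))
  bag-α≤2 (inj₂ (s , l)) =
    α≤-cliqueCover (Q MKI k n) _ (ColumnPair-clique _ _ ∷ Cell-clique _ _ ∷ All.[]) covering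
    where
      covering : ∀ {u} → bag (inj₂ (s , l)) u →
              Any (λ C → C u) (ColumnPair (ℕ.pred (toℕ s)) l ∷ Cell (suc (toℕ s)) l ∷ [])
      covering {x e _} (odd , refl , near) with close-cases near
      ... | inj₁ s≡e = here (upper (trans (sym s≡e) (sym (¬even⇒suc-pred odd))))
      ... | inj₂ (inj₁ above) = there (here (x∈ (sym above)))
      ... | inj₂ (inj₂ below) = here (lower (cong ℕ.pred below))

  αtw≤2 : αtw≤ (Q MKI k n) 2
  αtw≤2 = αtw≤-fromBags (Q MKI k n) bag subtree (coverEdges bag base-bag) bag-α≤2

lemma8p5 : ∀ (F : Family) (n : ℕ) → 3 ≤ n → αtw≤ (Q F n n) 2 × αloc≤ (Q F n n) 3
lemma8p5 MKI (suc n) _ = MKI.αtw≤2 n (suc n) , MKI.αloc≤3 n (suc n)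
lemma8p5 MKK (suc n) _ = AllApexes.αtw≤2 MKK n (suc n) tt , AllApexes.αloc≤3 MKK n (suc n) tt
lemma8p5 AKK (suc n) _ = AllApexes.αtw≤2 AKK n (suc n) tt , AllApexes.αloc≤3 AKK n (suc n) tt
lemma8p5 HKK (suc n) _ = AllApexes.αtw≤2 HKK n (suc n) tt , AllApexes.αloc≤3 HKK n (suc n) tt
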